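{- Let $L$ be a vocabulary with maximum relation arity $k$. For every $L$-structure $M$ of order $n$, $$BS_k(M)\le n+k-\sigma(M).$$
   Context: An $L$-structure $M$ has a finite universe $V(M)$ and relations $R^M:V(M)^l\to\{0,1\}$ for each $l$-ary symbol of $L$; its order is $|V(M)|$; the maximum relation arity is the largest arity of a symbol of $L$. For $a,b\in V(M)$, $a\sim b$ means the transposition of $a$ and $b$ is an automorphism of $M$; $\sim$ is an equivalence relation and $\sigma(M)$ is the maximum size of a $\sim$-class. A Bernays–Schönfinkel formula is one of the form $\exists y_1\ldots\exists y_p\forall x_1\ldots\forall x_r\,\Psi$ ($p,r\ge0$, $\Psi$ quantifier-free, over $L\cup\{=\}$). A closed formula identifies $M$ of order $n$ if it is true on $M$ and false on every $L$-structure of order $n$ not isomorphic to $M$. $BS_k(M)$ is the minimum of $p+r$ over Bernays–Schönfinkel formulas with $r\le k$ identifying $M$. -}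

module Defs where

open import Data.Nat using (ℕ; zero; suc; _+_; _∸_; _⊔_; _≤_)
open import Data.Fin using (Fin)
open import Data.Fin.Properties using (all?)
open import Data.Fin.Permutation using (Permutation′; _⟨$⟩ʳ_; transpose)
open import Data.Vec using (Vec; []; _∷_; map)
open import Data.Vec.Functional using (_++_)
open import Data.List using (List; length; filter; allFin; foldr)
import Data.List as List
open import Data.Bool using (Bool)
open import Data.Bool.Properties using () renaming (_≟_ to _≟ᵇ_)
open import Data.Product using (Σ; _×_; _,_; ∃)
open import Data.Empty using (⊥)
open import Data.Unit using (⊤)
open import Data.Sum using (_⊎_)
open import Relation.Nullary using (Dec; yes; no; ¬_)
open import Relation.Binary.PropositionalEquality using (_≡_)

record Vocabulary : Set where
  field
    size  : ℕ
    arity : Fin size → ℕ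
open Vocabulary public

maxArity′ : (s : ℕ) → (Fin s → ℕ) → ℕ
maxArity′ zero    a = 0
maxArity′ (suc s) a = a Fin.zero ⊔ maxArity′ s (λ i → a (Fin.suc i))

maxArity : Vocabulary → ℕ
maxArity L = maxArity′ (size L) (arity L)

record Structure (L : Vocabulary) (n : ℕ) : Set where
  field
    rel : (i : Fin (size L)) → Vec (Fin n) (arity L i) → Bool
open Structure public

_≅_ : ∀ {L n} → Structure L n → Structure L n → Set
_≅_ {L} {n} N M = Σ (Permutation′ n) λ f →
  ∀ i (t : Vec (Fin n) (arity L i)) → rel N i (map (f ⟨$⟩ʳ_) t) ≡ rel M i t

IsAutomorphism : ∀ {L n} → Structure L n → Permutation′ n → Set
IsAutomorphism {L} {n} M π =
  ∀ i (t : Vec (Fin n) (arity L i)) → rel M i (map (π ⟨$⟩ʳ_) t) ≡ rel M i t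

Sim : ∀ {L n} → Structure L n → Fin n → Fin n → Set
Sim M a b = IsAutomorphism M (transpose a b)

vecAll? : ∀ {n} l {P : Vec (Fin n) l → Set} →
          (∀ t → Dec (P t)) → Dec (∀ t → P t)
vecAll? zero P? with P? []
... | yes p = yes λ { [] → p }
... | no ¬p = no λ f → ¬p (f [])
vecAll? (suc l) {P} P? with all? (λ x → vecAll? l (λ t → P? (x ∷ t)))
... | yes f = yes λ { (x ∷ t) → f x t }
... | no ¬f = no λ g → ¬f (λ x t → g (x ∷ t))

sim? : ∀ {L n} (M : Structure L n) a b → Dec (Sim M a b)
sim? {L} M a b = all? (λ i → vecAll? (arity L i) (λ t →
  rel M i (map (transpose a b ⟨$⟩ʳ_) t) ≟ᵇ rel M i t))

classSize : ∀ {L n} → Structure L n → Fin n → ℕ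
classSize {n = n} M a = length (filter (sim? M a) (allFin n))

σ : ∀ {L n} → Structure L n → ℕ
σ {n = n} M = foldr _⊔_ 0 (List.map (classSize M) (allFin n))

data QF (L : Vocabulary) (m : ℕ) : Set where
  true false : QF L m
  atom  : (i : Fin (size L)) → Vec (Fin m) (arity L i) → QF L m
  equal : Fin m → Fin m → QF L m
  neg   : QF L m → QF L m
  conj disj : QF L m → QF L m → QF L m

⟦_⟧ : ∀ {L m n} → QF L m → Structure L n → (Fin m → Fin n) → Set
⟦ true ⟧      M ρ = ⊤
⟦ false ⟧     M ρ = ⊥
⟦ atom i vs ⟧ M ρ = rel M i (map ρ vs) ≡ Bool.true
⟦ equal u v ⟧ M ρ = ρ u ≡ ρ v
⟦ neg φ ⟧     M ρ = ¬ ⟦ φ ⟧ M ρ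
⟦ conj φ ψ ⟧  M ρ = ⟦ φ ⟧ M ρ × ⟦ ψ ⟧ M ρ
⟦ disj φ ψ ⟧  M ρ = ⟦ φ ⟧ M ρ ⊎ ⟦ ψ ⟧ M ρ

-- Bernays–Schönfinkel formula ∃y₁…∃y_p ∀x₁…∀x_r Ψ; the variables of Ψ are
-- Fin (p + r): the first p are the y's, the last r are the x's.
record BSFormula (L : Vocabulary) : Set where
  constructor ∃∀
  field
    p r  : ℕ
    body : QF L (p + r)
open BSFormula public

_⊨_ : ∀ {L n} → Structure L n → BSFormula L → Set
_⊨_ {n = n} M φ = ∃ λ (ys : Fin (p φ) → Fin n) →
  ∀ (xs : Fin (r φ) → Fin n) → ⟦ body φ ⟧ M (ys ++ xs)

Identifies : ∀ {L n} → BSFormula L → Structure L n → Set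
Identifies {L} {n} φ M =
  (M ⊨ φ) × (∀ (N : Structure L n) → ¬ (N ≅ M) → ¬ (N ⊨ φ))

BS[_]_≤_ : ∀ {L n} → ℕ → Structure L n → ℕ → Set
BS[_]_≤_ {L} k M b = ∃ λ (φ : BSFormula L) →
  r φ ≤ k × p φ + r φ ≤ b × Identifies φ M

-- Let C be a ∼-class of maximal size σ(M). Transpositions inside C are automorphisms and
-- generate all permutations of C, so the value of a relation on a tuple depends only on its
-- entries outside C and on the equality pattern of its entries in C. The n − σ(M)
-- existential variables name the elements outside C, and since arities are at most k,
-- k universal variables suffice to name the C-part of any tuple. The formula says: the
-- existential witnesses are distinct, and whenever the universal variables avoid them, the
-- whole assignment has the atomic diagram that M has at (outside C, w) for some w ∈ Cᵏ
-- with the same equality pattern. In a model N, any permutation sending the elements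
-- outside C to the witnesses is then an isomorphism onto M.

module Submission where

open import Defs
open import Data.Nat using (ℕ; zero; suc; _+_; _∸_; _≤_; _⊔_; z≤n; s≤s)
open import Data.Nat.Properties
  using (≤-refl; ≤-trans; ≤-reflexive; ⊔-lub; m≤m⊔n; m≤n⊔m; +-assoc; +-suc; ∸-monoʳ-≤; m+n∸m≡n)
open import Data.Fin using (Fin; zero; suc; _↑ˡ_; _↑ʳ_; splitAt)
open import Data.Fin.Properties using (_≟_; all?; ¬∀⟶∃¬)
open import Data.Fin.Permutation
  using (Permutation′; _⟨$⟩ʳ_; _⟨$⟩ˡ_; _≈_; transpose; _∘ₚ_; flip; inverseʳ)
  renaming (id to idₚ)
open import Data.Vec using (Vec; []; _∷_; map; lookup; tabulate)
open import Data.Vec.Properties using (map-∘; map-cong; map-id; lookup∘tabulate)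
open import Data.Vec.Functional using (_++_)
open import Data.Vec.Functional.Properties using (++-cong; lookup-++ˡ; lookup-++ʳ)
import Data.Vec.Functional as Vector
open import Data.List using (List; []; _∷_; filter; length; allFin)
import Data.List as List
open import Data.List.Properties using (length-tabulate; foldr-preservesᵇ)
open import Data.List.Extrema.Nat using (argmax; f[xs]≤f[argmax])
open import Data.List.Relation.Unary.All.Properties using (map⁺)
import Data.List.Relation.Unary.All as All
open import Data.List.Relation.Unary.AllPairs using ([]; _∷_)
open import Data.List.Relation.Unary.Unique.Propositional using (Unique)
open import Data.List.Relation.Unary.Unique.Propositional.Properties using (allFin⁺; filter⁺)
open import Data.List.Membership.Propositional.Properties using (∈-lookup; ∈-filter⁻; ∈-filter⁺; ∈-allFin)
open import Data.List.Relation.Unary.Any using (index)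
open import Data.List.Relation.Unary.Any.Properties using (lookup-index)
open import Data.Sum.Properties using ([,]-∘)
open import Data.Product using (∃; _×_; _,_; proj₁; proj₂)
open import Data.Sum using (inj₁; inj₂)
open import Data.Unit using (⊤; tt)
open import Data.Bool using (true)
open import Data.Bool.Properties using (⇔→≡) renaming (_≟_ to _≟ᵇ_)
open import Data.Empty using (⊥)
open import Function using (_∘_; _⇔_; mk⇔; Equivalence; Injective)
import Function.Properties.Equivalence as ⇔
open import Function.Properties.Inverse using (↔⇒↣)
open import Function.Bundles using (Injection)
open import Level using (0ℓ)
open import Relation.Nullary using (Dec; yes; no; ¬_; contradiction)
open import Relation.Unary using (Pred; Decidable)
open import Relation.Unary.Properties using (∁?)
open import Relation.Binary.PropositionalEquality
  using (_≡_; _≢_; _≗_; refl; sym; trans; cong; cong₂; subst; subst₂; module ≡-Reasoning)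

open Equivalence using (to; from)

private variable
  A B : Set
  n n′ m l k : ℕ
  x y z : Fin n
  π ρ : Permutation′ n

lookup-injective : {xs : List A} → Unique xs → Injective _≡_ _≡_ (List.lookup xs)
lookup-injective {xs = _ ∷ _} (_ ∷ _)      {zero}  {zero}  _  = refl
lookup-injective {xs = _ ∷ _} (x∉xs ∷ _)   {zero}  {suc j} eq = contradiction eq (All.lookup x∉xs (∈-lookup j))
lookup-injective {xs = _ ∷ _} (x∉xs ∷ _)   {suc i} {zero}  eq = contradiction (sym eq) (All.lookup x∉xs (∈-lookup i))
lookup-injective {xs = _ ∷ _} (_ ∷ unique) {suc i} {suc j} eq = cong suc (lookup-injective unique eq)

length-filter-∁ : {P : Pred A 0ℓ} (P? : Decidable P) (xs : List A) →
                  length (filter P? xs) + length (filter (∁? P?) xs) ≡ length xs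
length-filter-∁ P? [] = refl
length-filter-∁ P? (x ∷ xs) with P? x
... | yes _ = cong suc (length-filter-∁ P? xs)
... | no _  = trans (+-suc _ _) (cong suc (length-filter-∁ P? xs))

map-preimage : (f : A → B) (t : Vec B l) → (∀ q → ∃ λ v → f v ≡ lookup t q) →
               ∃ λ t′ → map f t′ ≡ t
map-preimage f []      _      = [] , refl
map-preimage f (z ∷ t) reach
  with v , fv≡z ← reach zero | t′ , ft′≡t ← map-preimage f t (reach ∘ suc) =
  v ∷ t′ , cong₂ _∷_ fv≡z ft′≡t

∘-++ : (h : A → B) (f : Fin m → A) (g : Fin k → A) → h ∘ (f ++ g) ≗ (h ∘ f) ++ (h ∘ g)
∘-++ {m = m} h f g v = [,]-∘ h (splitAt m v)

SameKernel : (Fin m → A) → (Fin m → B) → Set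
SameKernel f g = ∀ a b → f a ≡ f b ⇔ g a ≡ g b

module _ {f : Fin m → A} where

  SameKernel-sym : {g : Fin m → B} → SameKernel f g → SameKernel g f
  SameKernel-sym f~g a b = ⇔.sym (f~g a b)

  SameKernel-trans : {g : Fin m → B} {h : Fin m → Fin l} →
                     SameKernel f g → SameKernel g h → SameKernel f h
  SameKernel-trans f~g g~h a b = ⇔.trans (f~g a b) (g~h a b)

  ≗⇒SameKernel : {g : Fin m → A} → f ≗ g → SameKernel f g
  ≗⇒SameKernel f≗g a b = mk⇔ (λ eq → trans (sym (f≗g a)) (trans eq (f≗g b)))
                             (λ eq → trans (f≗g a) (trans eq (sym (f≗g b))))

  injective⇒SameKernel-id : Injective _≡_ _≡_ f → SameKernel f (λ a → a)
  injective⇒SameKernel-id f-inj a b = mk⇔ f-inj (cong f)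

  SameKernel-id⇒injective : SameKernel f (λ a → a) → Injective _≡_ _≡_ f
  SameKernel-id⇒injective f~id = to (f~id _ _)

  SameKernel-∘ : {h : A → B} → Injective _≡_ _≡_ h → SameKernel (h ∘ f) f
  SameKernel-∘ {h = h} h-inj a b = mk⇔ h-inj (cong h)

transpose-matchˡ : (x y : Fin n) → transpose x y ⟨$⟩ʳ x ≡ y
transpose-matchˡ x y with x ≟ x
... | yes _   = refl
... | no x≢x = contradiction refl x≢x

transpose-matchʳ : (x y : Fin n) → transpose x y ⟨$⟩ʳ y ≡ x
transpose-matchʳ x y with y ≟ x
... | yes y≡x = y≡x
... | no _ with y ≟ y
...   | yes _   = refl
...   | no y≢y = contradiction refl y≢y

transpose-mismatch : z ≢ x → z ≢ y → transpose x y ⟨$⟩ʳ z ≡ z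
transpose-mismatch {z = z} {x} {y} z≢x z≢y with z ≟ x
... | yes z≡x = contradiction z≡x z≢x
... | no _ with z ≟ y
...   | yes z≡y = contradiction z≡y z≢y
...   | no _    = refl

transpose-same : (x z : Fin n) → transpose x x ⟨$⟩ʳ z ≡ z
transpose-same x z with z ≟ x
... | yes z≡x = sym z≡x
... | no z≢x with z ≟ x
...   | yes z≡x = contradiction z≡x z≢x
...   | no _    = refl

transpose-comm : (x y z : Fin n) → transpose x y ⟨$⟩ʳ z ≡ transpose y x ⟨$⟩ʳ z
transpose-comm x y z = by-cases (z ≟ x) (z ≟ y)
  where
  by-cases : Dec (z ≡ x) → Dec (z ≡ y) → transpose x y ⟨$⟩ʳ z ≡ transpose y x ⟨$⟩ʳ z
  by-cases (yes refl) _        = trans (transpose-matchˡ z y) (sym (transpose-matchʳ y z))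
  by-cases (no z≢x)   (yes refl) = trans (transpose-matchʳ x z) (sym (transpose-matchˡ z x))
  by-cases (no z≢x)   (no z≢y)   =
    trans (transpose-mismatch z≢x z≢y) (sym (transpose-mismatch z≢y z≢x))

transpose-closed : ∀ {P : Pred (Fin n) 0ℓ} → P x → P y → P z → P (transpose x y ⟨$⟩ʳ z)
transpose-closed {x = x} {y} {z} Px Py Pz with z ≟ x
... | yes _ = Py
... | no _ with z ≟ y
...   | yes _ = Px
...   | no _  = Pz

transpose-conjugate : {f : Fin n → Fin m} → Injective _≡_ _≡_ f → (x y z : Fin n) →
                      f (transpose x y ⟨$⟩ʳ z) ≡ transpose (f x) (f y) ⟨$⟩ʳ f z
transpose-conjugate {f = f} f-inj x y z with z ≟ x
... | yes refl = sym (transpose-matchˡ (f z) (f y))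
... | no z≢x with z ≟ y
...   | yes refl = sym (transpose-matchʳ (f x) (f z))
...   | no z≢y   = sym (transpose-mismatch (z≢x ∘ f-inj) (z≢y ∘ f-inj))

⟨$⟩ʳ-injective : (π : Permutation′ n) → Injective _≡_ _≡_ (π ⟨$⟩ʳ_)
⟨$⟩ʳ-injective π = Injection.injective (↔⇒↣ π)

module _ {L : Vocabulary} (M : Structure L n) where

  aut-cong : (π ρ : Permutation′ n) → π ≈ ρ → IsAutomorphism M π → IsAutomorphism M ρ
  aut-cong π ρ π≈ρ π-aut i t = trans (cong (rel M i) (map-cong (sym ∘ π≈ρ) t)) (π-aut i t)

  aut-id : IsAutomorphism M idₚ
  aut-id i t = cong (rel M i) (map-id t)

  aut-∘ₚ : (π ρ : Permutation′ n) →
           IsAutomorphism M π → IsAutomorphism M ρ → IsAutomorphism M (π ∘ₚ ρ)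
  aut-∘ₚ π ρ π-aut ρ-aut i t =
    trans (cong (rel M i) (map-∘ (ρ ⟨$⟩ʳ_) (π ⟨$⟩ʳ_) t)) (trans (ρ-aut i _) (π-aut i t))

  aut-flip : (π : Permutation′ n) → IsAutomorphism M π → IsAutomorphism M (flip π)
  aut-flip π π-aut i t = begin
    rel M i (map (π ⟨$⟩ˡ_) t)                   ≡⟨ π-aut i _ ⟨
    rel M i (map (π ⟨$⟩ʳ_) (map (π ⟨$⟩ˡ_) t))   ≡⟨ cong (rel M i) (map-∘ _ _ t) ⟨
    rel M i (map (λ z → π ⟨$⟩ʳ (π ⟨$⟩ˡ z)) t)   ≡⟨ cong (rel M i) (map-cong (λ _ → inverseʳ π) t) ⟩
    rel M i (map (λ z → z) t)                   ≡⟨ aut-id i t ⟩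
    rel M i t                                   ∎
    where open ≡-Reasoning

  Sim-refl : Sim M x x
  Sim-refl {x = x} = aut-cong idₚ (transpose x x) (λ z → sym (transpose-same x z)) aut-id

  Sim-sym : Sim M x y → Sim M y x
  Sim-sym {x = x} {y} = aut-cong (transpose x y) (transpose y x) (transpose-comm x y)

  Sim-conj : (π : Permutation′ n) → IsAutomorphism M π → Sim M x y → Sim M (π ⟨$⟩ʳ x) (π ⟨$⟩ʳ y)
  Sim-conj {x = x} {y} π π-aut x∼y =
    aut-cong (flip π ∘ₚ transpose x y ∘ₚ π) (transpose (π ⟨$⟩ʳ x) (π ⟨$⟩ʳ y)) conjugate
      (aut-∘ₚ (flip π) (transpose x y ∘ₚ π) (aut-flip π π-aut) (aut-∘ₚ (transpose x y) π x∼y π-aut))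
    where
    conjugate : flip π ∘ₚ transpose x y ∘ₚ π ≈ transpose (π ⟨$⟩ʳ x) (π ⟨$⟩ʳ y)
    conjugate z = trans (transpose-conjugate (⟨$⟩ʳ-injective π) x y (π ⟨$⟩ˡ z))
                        (cong (transpose _ _ ⟨$⟩ʳ_) (inverseʳ π))

  Sim-trans : Sim M x y → Sim M y z → Sim M x z
  Sim-trans {x = x} {y} {z} x∼y y∼z with z ≟ x | z ≟ y
  ... | yes refl | _        = Sim-refl
  ... | no _     | yes refl = x∼y
  ... | no z≢x   | no z≢y   =
    subst₂ (Sim M) (transpose-matchʳ x y) (transpose-mismatch z≢x z≢y) (Sim-conj (transpose x y) x∼y y∼z)

data Sym (D : Pred (Fin n) 0ℓ) : Permutation′ n → Set where
  identity : Sym D idₚ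
  swap     : Sym D π → D x → D y → Sym D (π ∘ₚ transpose x y)

module _ {D : Pred (Fin n) 0ℓ} where

  Sym-preserves : Sym D π → D z → D (π ⟨$⟩ʳ z)
  Sym-preserves identity          Dz = Dz
  Sym-preserves (swap π∈ Dx Dy)   Dz = transpose-closed {P = D} Dx Dy (Sym-preserves π∈ Dz)

  Sym-fixes : Sym D π → ¬ D z → π ⟨$⟩ʳ z ≡ z
  Sym-fixes identity _ = refl
  Sym-fixes {z = z} (swap {x = x} {y} π∈ Dx Dy) ¬Dz =
    trans (cong (transpose x y ⟨$⟩ʳ_) (Sym-fixes π∈ ¬Dz))
          (transpose-mismatch (λ z≡x → ¬Dz (subst D (sym z≡x) Dx)) (λ z≡y → ¬Dz (subst D (sym z≡y) Dy)))

  Sym-automorphism : {L : Vocabulary} (M : Structure L n) →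
                     (∀ {x y} → D x → D y → Sim M x y) → Sym D π → IsAutomorphism M π
  Sym-automorphism M clique identity = aut-id M
  Sym-automorphism M clique (swap {π = π} {x} {y} π∈ Dx Dy) =
    aut-∘ₚ M π (transpose x y) (Sym-automorphism M clique π∈) (clique Dx Dy)

  Sym-extend : (u v : Fin m → Fin n) → (∀ j → D (u j)) → (∀ j → D (v j)) → SameKernel u v →
               ∃ λ π → Sym D π × (∀ j → π ⟨$⟩ʳ u j ≡ v j)
  Sym-extend {zero}  u v _ _ _ = idₚ , identity , λ ()
  Sym-extend {suc m} u v Du Dv u~v
    with π , π∈ , πu≡v ← Sym-extend (u ∘ suc) (v ∘ suc) (Du ∘ suc) (Dv ∘ suc) (λ a b → u~v (suc a) (suc b)) =
    π ∘ₚ transpose a (v zero) , swap π∈ (Sym-preserves π∈ (Du zero)) (Dv zero) , moves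
    where
    a : Fin n
    a = π ⟨$⟩ʳ u zero
    -- The new transposition sends a to v 0 and, by the kernel condition, fixes every v j ≠ v 0.
    moves : ∀ j → transpose a (v zero) ⟨$⟩ʳ (π ⟨$⟩ʳ u j) ≡ v j
    moves zero    = transpose-matchˡ a (v zero)
    moves (suc j) with v (suc j) ≟ v zero
    ... | yes vj≡v0 = begin
      transpose a (v zero) ⟨$⟩ʳ (π ⟨$⟩ʳ u (suc j)) ≡⟨ cong (transpose a (v zero) ⟨$⟩ʳ_) (trans (πu≡v j) vj≡v0) ⟩
      transpose a (v zero) ⟨$⟩ʳ v zero             ≡⟨ transpose-matchʳ a (v zero) ⟩
      π ⟨$⟩ʳ u zero                                ≡⟨ cong (π ⟨$⟩ʳ_) (from (u~v zero (suc j)) (sym vj≡v0)) ⟩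
      π ⟨$⟩ʳ u (suc j)                             ≡⟨ πu≡v j ⟩
      v (suc j)                                    ∎
      where open ≡-Reasoning
    ... | no vj≢v0 = trans (cong (transpose a (v zero) ⟨$⟩ʳ_) (πu≡v j))
                           (transpose-mismatch vj≢a vj≢v0)
      where
      vj≢a : v (suc j) ≢ a
      vj≢a vj≡a = vj≢v0 (to (u~v (suc j) zero)
                              (⟨$⟩ʳ-injective π (trans (πu≡v j) vj≡a)))

extend-injection : (u v : Fin m → Fin n) → Injective _≡_ _≡_ u → Injective _≡_ _≡_ v →
                   ∃ λ (π : Permutation′ n) → ∀ j → π ⟨$⟩ʳ u j ≡ v j
extend-injection u v u-inj v-inj
  with π , _ , πu≡v ← Sym-extend {D = λ _ → ⊤} u v _ _
         (SameKernel-trans (injective⇒SameKernel-id u-inj) (SameKernel-sym (injective⇒SameKernel-id v-inj))) =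
  π , πu≡v

module _ {L : Vocabulary} (M : Structure L n) {D : Pred (Fin n) 0ℓ}
         (clique : ∀ {x y} → D x → D y → Sim M x y) where

  rel-invariant : {f : Fin m → Fin n} {g h : Fin k → Fin n} →
                  (∀ j → ¬ D (f j)) → (∀ a → D (g a)) → (∀ a → D (h a)) → SameKernel g h →
                  ∀ i (t : Vec (Fin (m + k)) (arity L i)) →
                  rel M i (map (f ++ g) t) ≡ rel M i (map (f ++ h) t)
  rel-invariant {f = f} {g} {h} f∉D g∈D h∈D g~h i t
    with π , π∈ , πg≡h ← Sym-extend g h g∈D h∈D g~h = begin
      rel M i (map (f ++ g) t)                   ≡⟨ Sym-automorphism M clique π∈ i _ ⟨
      rel M i (map (π ⟨$⟩ʳ_) (map (f ++ g) t))   ≡⟨ cong (rel M i) (map-∘ _ _ t) ⟨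
      rel M i (map ((π ⟨$⟩ʳ_) ∘ (f ++ g)) t)     ≡⟨ cong (rel M i) (map-cong moves t) ⟩
      rel M i (map (f ++ h) t)                   ∎
    where
    open ≡-Reasoning
    moves : (π ⟨$⟩ʳ_) ∘ (f ++ g) ≗ f ++ h
    moves v = trans (∘-++ (π ⟨$⟩ʳ_) f g v) (++-cong _ f (λ j → Sym-fixes π∈ (f∉D j)) πg≡h v)

module _ {L : Vocabulary} {m : ℕ} where

  ⋀ ⋁ : (k : ℕ) → (Fin k → QF L m) → QF L m
  ⋀ zero    G = true
  ⋀ (suc k) G = conj (G zero) (⋀ k (G ∘ suc))
  ⋁ zero    G = false
  ⋁ (suc k) G = disj (G zero) (⋁ k (G ∘ suc))

  ⋀ⱽ ⋁ⱽ : (k l : ℕ) → (Vec (Fin k) l → QF L m) → QF L m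
  ⋀ⱽ k zero    G = G []
  ⋀ⱽ k (suc l) G = ⋀ k λ z → ⋀ⱽ k l (G ∘ (z ∷_))
  ⋁ⱽ k zero    G = G []
  ⋁ⱽ k (suc l) G = ⋁ k λ z → ⋁ⱽ k l (G ∘ (z ∷_))

  lit guarded : {P : Set} → Dec P → QF L m → QF L m
  lit (yes _) φ = φ
  lit (no _)  φ = neg φ
  guarded (yes _) φ = φ
  guarded (no _)  φ = false

  EqualityType : (Fin k → Fin n) → (Fin k → Fin m) → QF L m
  EqualityType w vs = ⋀ _ λ a → ⋀ _ λ b → lit (w a ≟ w b) (equal (vs a) (vs b))

  Apart : (Fin k → Fin m) → (Fin l → Fin m) → QF L m
  Apart us vs = ⋀ _ λ a → ⋀ _ λ j → neg (equal (us a) (vs j))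

  Diagram : Structure L n → (Fin m → Fin n) → QF L m
  Diagram M f = ⋀ (size L) λ i → ⋀ⱽ m (arity L i) λ t → lit (rel M i (map f t) ≟ᵇ true) (atom i t)

module _ {L : Vocabulary} {m : ℕ} (N : Structure L n) (ρ : Fin m → Fin n) where

  ⋀-sem : (k : ℕ) (G : Fin k → QF L m) → ⟦ ⋀ k G ⟧ N ρ ⇔ (∀ j → ⟦ G j ⟧ N ρ)
  ⋀-sem zero    G = mk⇔ (λ _ ()) (λ _ → tt)
  ⋀-sem (suc k) G = mk⇔
    (λ (h , hs) → λ { zero → h ; (suc j) → to (⋀-sem k (G ∘ suc)) hs j })
    (λ hs → hs zero , from (⋀-sem k (G ∘ suc)) (hs ∘ suc))

  ⋁-sem : (k : ℕ) (G : Fin k → QF L m) → ⟦ ⋁ k G ⟧ N ρ ⇔ ∃ λ j → ⟦ G j ⟧ N ρ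
  ⋁-sem zero    G = mk⇔ (λ ()) (λ ())
  ⋁-sem (suc k) G = mk⇔
    (λ { (inj₁ h) → zero , h ; (inj₂ h) → let j , hj = to (⋁-sem k (G ∘ suc)) h in suc j , hj })
    (λ { (zero , h) → inj₁ h ; (suc j , h) → inj₂ (from (⋁-sem k (G ∘ suc)) (j , h)) })

  ⋀ⱽ-sem : (k l : ℕ) (G : Vec (Fin k) l → QF L m) → ⟦ ⋀ⱽ k l G ⟧ N ρ ⇔ (∀ t → ⟦ G t ⟧ N ρ)
  ⋀ⱽ-sem k zero    G = mk⇔ (λ { h [] → h }) (λ hs → hs [])
  ⋀ⱽ-sem k (suc l) G = mk⇔
    (λ { h (z ∷ t) → to (⋀ⱽ-sem k l (G ∘ (z ∷_))) (to (⋀-sem k _) h z) t })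
    (λ hs → from (⋀-sem k _) λ z → from (⋀ⱽ-sem k l (G ∘ (z ∷_))) λ t → hs (z ∷ t))

  ⋁ⱽ-sem : (k l : ℕ) (G : Vec (Fin k) l → QF L m) → ⟦ ⋁ⱽ k l G ⟧ N ρ ⇔ ∃ λ t → ⟦ G t ⟧ N ρ
  ⋁ⱽ-sem k zero    G = mk⇔ ([] ,_) (λ { ([] , h) → h })
  ⋁ⱽ-sem k (suc l) G = mk⇔
    (λ h → let z , hz = to (⋁-sem k _) h
               t , ht = to (⋁ⱽ-sem k l (G ∘ (z ∷_))) hz
           in z ∷ t , ht)
    (λ { (z ∷ t , h) → from (⋁-sem k _) (z , from (⋁ⱽ-sem k l (G ∘ (z ∷_))) (t , h)) })

  lit-sem : {P : Set} (d : Dec P) (φ : QF L m) → ⟦ lit d φ ⟧ N ρ ⇔ (⟦ φ ⟧ N ρ ⇔ P)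
  lit-sem (yes p) φ = mk⇔ (λ h → mk⇔ (λ _ → p) (λ _ → h)) (λ h⇔p → from h⇔p p)
  lit-sem (no ¬p) φ = mk⇔ (λ ¬h → mk⇔ (λ h → contradiction h ¬h) (λ p → contradiction p ¬p))
                          (λ h⇔p h → ¬p (to h⇔p h))

  guarded-sem : {P : Set} (d : Dec P) (φ : QF L m) → ⟦ guarded d φ ⟧ N ρ ⇔ (P × ⟦ φ ⟧ N ρ)
  guarded-sem (yes p) φ = mk⇔ (p ,_) proj₂
  guarded-sem (no ¬p) φ = mk⇔ (λ ()) (λ (p , _) → ¬p p)

  EqualityType-sem : (w : Fin k → Fin n′) (vs : Fin k → Fin m) →
                     ⟦ EqualityType w vs ⟧ N ρ ⇔ SameKernel (ρ ∘ vs) w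
  EqualityType-sem w vs = mk⇔
    (λ h a b → to (lit-sem (w a ≟ w b) _) (to (⋀-sem _ _) (to (⋀-sem _ _) h a) b))
    (λ ρvs~w → from (⋀-sem _ _) λ a → from (⋀-sem _ _) λ b → from (lit-sem (w a ≟ w b) _) (ρvs~w a b))

  Apart-sem : (us : Fin k → Fin m) (vs : Fin l → Fin m) →
              ⟦ Apart us vs ⟧ N ρ ⇔ (∀ a j → ρ (us a) ≢ ρ (vs j))
  Apart-sem us vs = mk⇔
    (λ h a j → to (⋀-sem _ _) (to (⋀-sem _ _) h a) j)
    (λ apart → from (⋀-sem _ _) λ a → from (⋀-sem _ _) (apart a))

  Diagram-sem : (M : Structure L n′) (f : Fin m → Fin n′) →
                ⟦ Diagram M f ⟧ N ρ ⇔ (∀ i t → rel N i (map ρ t) ≡ rel M i (map f t))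
  Diagram-sem M f = mk⇔
    (λ h i t → ⇔→≡ (to (lit-sem (_ ≟ᵇ true) _) (to (⋀ⱽ-sem _ _ _) (to (⋀-sem _ _) h i) t)))
    (λ agree → from (⋀-sem _ _) λ i → from (⋀ⱽ-sem _ _ _) λ t → from (lit-sem (_ ≟ᵇ true) _)
       (mk⇔ (trans (sym (agree i t))) (trans (agree i t))))

record Cover (D : Pred (Fin n) 0ℓ) (k : ℕ) (t : Vec (Fin n) l) : Set where
  field
    xs     : Fin k → Fin n
    xs∈D   : ∀ a → D (xs a)
    covers : ∀ q → D (lookup t q) → ∃ λ a → xs a ≡ lookup t q

padded-cover : {D : Pred (Fin n) 0ℓ} → Decidable D → D z → l ≤ k → (t : Vec (Fin n) l) → Cover D k t
padded-cover {z = c} D? Dc z≤n [] = record { xs = λ _ → c ; xs∈D = λ _ → Dc ; covers = λ () }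
padded-cover {z = c} D? Dc (s≤s l≤k) (z ∷ t) with D? z
... | yes Dz = record
  { xs     = z Vector.∷ xs
  ; xs∈D   = λ { zero → Dz ; (suc a) → xs∈D a }
  ; covers = λ { zero _ → zero , refl ; (suc q) Dtq → let a , eq = covers q Dtq in suc a , eq }
  } where open Cover (padded-cover D? Dc l≤k t)
... | no ¬Dz = record
  { xs     = c Vector.∷ xs
  ; xs∈D   = λ { zero → Dc ; (suc a) → xs∈D a }
  ; covers = λ { zero Dz → contradiction Dz ¬Dz ; (suc q) Dtq → let a , eq = covers q Dtq in suc a , eq }
  } where open Cover (padded-cover D? Dc l≤k t)

-- pad only serves to instantiate the universal variables once, which forces the witnesses
-- to be distinct.
module Identification {L : Vocabulary} (M : Structure L n)
  {D : Pred (Fin n) 0ℓ} (D? : Decidable D) (clique : ∀ {x y} → D x → D y → Sim M x y)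
  {k : ℕ} (pad : Fin k → Fin n) (cover : ∀ i (t : Vec (Fin n) (arity L i)) → Cover D k t)
  where

  outside : List (Fin n)
  outside = filter (∁? D?) (allFin n)

  ∣outside∣ : ℕ
  ∣outside∣ = length outside

  e : Fin ∣outside∣ → Fin n
  e = List.lookup outside

  e-injective : Injective _≡_ _≡_ e
  e-injective = lookup-injective (filter⁺ (∁? D?) (allFin⁺ n))

  e∉D : ∀ j → ¬ D (e j)
  e∉D j = proj₂ (∈-filter⁻ (∁? D?) {xs = allFin n} (∈-lookup j))

  e-surjective : ∀ z → ¬ D z → ∃ λ j → e j ≡ z
  e-surjective z ¬Dz = index z∈outside , sym (lookup-index z∈outside)
    where z∈outside = ∈-filter⁺ (∁? D?) (∈-allFin z) ¬Dz

  ∃var : Fin ∣outside∣ → Fin (∣outside∣ + k)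
  ∃var = _↑ˡ k

  ∀var : Fin k → Fin (∣outside∣ + k)
  ∀var = ∣outside∣ ↑ʳ_

  Distinct Fresh : QF L (∣outside∣ + k)
  Distinct = EqualityType (λ j → j) ∃var
  Fresh    = Apart ∀var ∃var

  LooksLike : Vec (Fin n) k → QF L (∣outside∣ + k)
  LooksLike w = guarded (all? (D? ∘ lookup w))
                        (conj (EqualityType (lookup w) ∀var) (Diagram M (e ++ lookup w)))

  ψ : QF L (∣outside∣ + k)
  ψ = conj Distinct (disj (neg Fresh) (⋁ⱽ n k LooksLike))

  φ : BSFormula L
  φ = ∃∀ ∣outside∣ k ψ

  module _ (N : Structure L n) (ys : Fin ∣outside∣ → Fin n) (xs : Fin k → Fin n)
           (ψ-holds : ⟦ ψ ⟧ N (ys ++ xs)) where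

    ψ⇒injective : Injective _≡_ _≡_ ys
    ψ⇒injective = SameKernel-id⇒injective (SameKernel-trans
      (≗⇒SameKernel (sym ∘ lookup-++ˡ ys xs))
      (to (EqualityType-sem N (ys ++ xs) (λ j → j) ∃var) (proj₁ ψ-holds)))

    ψ⇒diagram : (∀ a j → xs a ≢ ys j) →
                ∃ λ w → (∀ a → D (w a)) × SameKernel xs w ×
                        (∀ i t → rel N i (map (ys ++ xs) t) ≡ rel M i (map (e ++ w) t))
    ψ⇒diagram apart with proj₂ ψ-holds
    ... | inj₁ ¬fresh = contradiction (from (Apart-sem N (ys ++ xs) ∀var ∃var) λ a j →
      apart a j ∘ λ eq → trans (sym (lookup-++ʳ ys xs a)) (trans eq (lookup-++ˡ ys xs j))) ¬fresh
    ... | inj₂ some-w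
      with w , w-holds ← to (⋁ⱽ-sem N (ys ++ xs) n k LooksLike) some-w
      with w∈D , same-type , same-diagram ← to (guarded-sem N (ys ++ xs) (all? (D? ∘ lookup w)) _) w-holds =
      lookup w , w∈D ,
      SameKernel-trans (≗⇒SameKernel (sym ∘ lookup-++ʳ ys xs))
                       (to (EqualityType-sem N (ys ++ xs) (lookup w) ∀var) same-type) ,
      to (Diagram-sem N (ys ++ xs) M (e ++ lookup w)) same-diagram

  M⊨φ : M ⊨ φ
  M⊨φ = e , λ xs → distinct xs , fresh⇒looks-like xs (all? (D? ∘ xs))
    where
    distinct : ∀ xs → ⟦ Distinct ⟧ M (e ++ xs)
    distinct xs = from (EqualityType-sem M (e ++ xs) (λ j → j) ∃var)
      (SameKernel-trans (≗⇒SameKernel (lookup-++ˡ e xs)) (injective⇒SameKernel-id e-injective))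

    fresh⇒looks-like : ∀ xs → Dec (∀ a → D (xs a)) → ⟦ disj (neg Fresh) (⋁ⱽ n k LooksLike) ⟧ M (e ++ xs)
    fresh⇒looks-like xs (no ¬xs∈D) = inj₁ λ fresh →
      let a , ¬D = ¬∀⟶∃¬ k _ (D? ∘ xs) ¬xs∈D
          j , ej≡xa = e-surjective (xs a) ¬D
      in to (Apart-sem M (e ++ xs) ∀var ∃var) fresh a j
            (trans (lookup-++ʳ e xs a) (trans (sym ej≡xa) (sym (lookup-++ˡ e xs j))))
    fresh⇒looks-like xs (yes xs∈D) = inj₂ (from (⋁ⱽ-sem M (e ++ xs) n k LooksLike) (w ,
      from (guarded-sem M (e ++ xs) (all? (D? ∘ lookup w)) _)
        ( (λ a → subst D (sym (w≗xs a)) (xs∈D a))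
        , from (EqualityType-sem M (e ++ xs) (lookup w) ∀var)
            (≗⇒SameKernel λ a → trans (lookup-++ʳ e xs a) (sym (w≗xs a)))
        , from (Diagram-sem M (e ++ xs) M (e ++ lookup w))
            (λ i t → cong (rel M i) (map-cong (++-cong e e (λ _ → refl) (sym ∘ w≗xs)) t)))))
      where
      w : Vec (Fin n) k
      w = tabulate xs
      w≗xs : lookup w ≗ xs
      w≗xs = lookup∘tabulate xs

  cover-preimage : (t : Vec (Fin n) l) (c : Cover D k t) → ∃ λ t′ → map (e ++ Cover.xs c) t′ ≡ t
  cover-preimage t c = map-preimage (e ++ xs) t reach
    where
    open Cover c
    reach : ∀ q → ∃ λ v → (e ++ xs) v ≡ lookup t q
    reach q with D? (lookup t q)
    ... | yes D-tq = let a , xa≡tq = covers q D-tq in ∀var a , trans (lookup-++ʳ e xs a) xa≡tq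
    ... | no ¬D-tq = let j , ej≡tq = e-surjective _ ¬D-tq in ∃var j , trans (lookup-++ˡ e xs j) ej≡tq

  ⊨⇒≅ : (N : Structure L n) → N ⊨ φ → N ≅ M
  ⊨⇒≅ N (ys , ψ-holds)
    with π , πe≗ys ← extend-injection e ys e-injective (ψ⇒injective N ys pad (ψ-holds pad)) =
    π , preserves
    where
    fresh : {t : Vec (Fin n) l} (c : Cover D k t) → ∀ a j → π ⟨$⟩ʳ Cover.xs c a ≢ ys j
    fresh c a j πxa≡yj =
      e∉D j (subst D (⟨$⟩ʳ-injective π (trans πxa≡yj (sym (πe≗ys j)))) (Cover.xs∈D c a))

    preserves : ∀ i t → rel N i (map (π ⟨$⟩ʳ_) t) ≡ rel M i t
    preserves i t
      with t′ , e++xs[t′]≡t ← cover-preimage t (cover i t)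
      with w , w∈D , πxs~w , diagram ← ψ⇒diagram N ys ((π ⟨$⟩ʳ_) ∘ Cover.xs (cover i t))
                                                  (ψ-holds _) (fresh (cover i t)) = begin
      rel N i (map (π ⟨$⟩ʳ_) t)                   ≡⟨ cong (rel N i ∘ map _) e++xs[t′]≡t ⟨
      rel N i (map (π ⟨$⟩ʳ_) (map (e ++ xs) t′))  ≡⟨ cong (rel N i) (map-∘ _ _ t′) ⟨
      rel N i (map ((π ⟨$⟩ʳ_) ∘ (e ++ xs)) t′)    ≡⟨ cong (rel N i) (map-cong moves t′) ⟩
      rel N i (map (ys ++ πxs) t′)                ≡⟨ diagram i t′ ⟩
      rel M i (map (e ++ w) t′)                   ≡⟨ rel-invariant M clique e∉D w∈D xs∈D w~xs i t′ ⟩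
      rel M i (map (e ++ xs) t′)                  ≡⟨ cong (rel M i) e++xs[t′]≡t ⟩
      rel M i t                                   ∎
      where
      open ≡-Reasoning
      open Cover (cover i t)
      πxs : Fin k → Fin n
      πxs = (π ⟨$⟩ʳ_) ∘ xs
      moves : (π ⟨$⟩ʳ_) ∘ (e ++ xs) ≗ ys ++ πxs
      moves v = trans (∘-++ (π ⟨$⟩ʳ_) e xs v) (++-cong _ ys πe≗ys (λ _ → refl) v)
      w~xs : SameKernel w xs
      w~xs = SameKernel-sym (SameKernel-trans (SameKernel-sym (SameKernel-∘ (⟨$⟩ʳ-injective π))) πxs~w)

  identifies : Identifies φ M
  identifies = M⊨φ , λ N N≇M N⊨φ → N≇M (⊨⇒≅ N N⊨φ)

arity≤maxArity′ : (s : ℕ) (a : Fin s → ℕ) (i : Fin s) → a i ≤ maxArity′ s a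
arity≤maxArity′ (suc s) a zero    = m≤m⊔n _ _
arity≤maxArity′ (suc s) a (suc i) = ≤-trans (arity≤maxArity′ s (a ∘ suc) i) (m≤n⊔m _ _)

largest-class-rep : {L : Vocabulary} → Structure L (suc n) → Fin (suc n)
largest-class-rep {n = n} M = argmax (classSize M) zero (allFin (suc n))

σ≤largest-class-rep : {L : Vocabulary} (M : Structure L (suc n)) → σ M ≤ classSize M (largest-class-rep M)
σ≤largest-class-rep {n = n} M =
  foldr-preservesᵇ {P = _≤ classSize M (largest-class-rep M)} {f = _⊔_} ⊔-lub z≤n (map⁺ (f[xs]≤f[argmax] zero (allFin (suc n))))

complement-size : ∀ {a d n} k → a + d ≡ n → n + k ∸ a ≡ d + k
complement-size {a} {d} {n} k a+d≡n = begin
  n + k ∸ a       ≡⟨ cong (λ n → n + k ∸ a) a+d≡n ⟨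
  a + d + k ∸ a   ≡⟨ cong (_∸ a) (+-assoc a d k) ⟩
  a + (d + k) ∸ a ≡⟨ m+n∸m≡n a (d + k) ⟩
  d + k           ∎
  where open ≡-Reasoning

BS-weaken : ∀ {L} {M : Structure L n} {b b′} → b ≤ b′ → BS[ k ] M ≤ b → BS[ k ] M ≤ b′
BS-weaken b≤b′ (φ , r≤k , size≤b , φ-identifies) = φ , r≤k , ≤-trans size≤b b≤b′ , φ-identifies

class-bound : {L : Vocabulary} (M : Structure L n) (c : Fin n) →
              BS[ maxArity L ] M ≤ (n + maxArity L ∸ classSize M c)
class-bound {n = n} {L} M c =
  φ , ≤-refl , ≤-reflexive (sym (complement-size (maxArity L) partition)) , identifies
  where
  open Identification M (sim? M c) (λ c∼x c∼y → Sim-trans M (Sim-sym M c∼x) c∼y) (λ _ → c)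
    (λ i → padded-cover (sim? M c) (Sim-refl M) (arity≤maxArity′ (size L) (arity L) i))
  partition : classSize M c + ∣outside∣ ≡ n
  partition = trans (length-filter-∁ (sim? M c) (allFin n)) (length-tabulate (λ x → x))

proposition5p2 : (L : Vocabulary) (n : ℕ) (M : Structure L n) →
    BS[ maxArity L ] M ≤ (n + maxArity L ∸ σ M)
proposition5p2 L zero M = φ , z≤n , z≤n , identifies
  where
  empty-cover : ∀ {l} (t : Vec (Fin 0) l) → Cover (λ _ → ⊥) 0 t
  empty-cover _ = record { xs = λ () ; xs∈D = λ () ; covers = λ _ () }
  open Identification M {D = λ _ → ⊥} (λ _ → no λ ()) (λ ()) {k = 0} (λ ()) (λ _ → empty-cover)
proposition5p2 L (suc n) M =
  BS-weaken (∸-monoʳ-≤ (suc n + maxArity L) (σ≤largest-class-rep M)) (class-bound M (largest-class-rep M))
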